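{- Let $w$ be a finite Sturmian word. Then there exists a finite Sturmian word $w'$ such that $w$ is a prefix of $w'$ and, writing $N = |w'|$ and letting $\ell' \in \mathcal{L}_N$ be the line with $w' \in m(\ell')$, the word $w'$ goes through every integer point $(i,j)$ of $\ell'$ with $0 \leq i \leq N$.
   Context: An infinite binary word over $\{0,1\}$ is Sturmian if it has exactly $k+1$ distinct factors of length $k$ for every $k \geq 0$; a finite Sturmian word is a factor of some infinite Sturmian word. Let $A_n$ be the set of finite Sturmian words of length $n$. A line $y = \alpha x + \rho$ with $\alpha, \rho \in (0,1)$ defines the word $a_0 a_1 \cdots a_{n-1}$, where $a_k = \lfloor (k+1)\alpha + \rho \rfloor - \lfloor k\alpha + \rho \rfloor$; a binary word of length $n$ lies in $A_n$ iff it is defined by such a line. Let $\mathcal{S}_n$ be the set of lines $y = \alpha x + \rho$ with $\alpha, \rho \in (0,1)$, in the grid $[0,n]\times[0,n]$. For a line $\ell$ and real $k$, $\mathbb{Z}_k(\ell)$ is the number of integer points $(i,j)$ on $\ell$ with $0 \leq i \leq k$. $\mathcal{L}_n$ is the set of lines $y = \alpha x + \rho$ with $\alpha \in [0,1]$, $\rho \in [0,1]$ and $\mathbb{Z}_n(\ell) \geq 2$. The map $m \colon \mathcal{L}_n \to 2^{A_n}$ is defined by: $w \in m(\ell)$ iff there is $\ell' \in \mathcal{S}_n$ such that (i) $\ell'$ defines $w$; (ii) no integer grid points of $[0,n]\times[0,n]$ lie between $\ell$ and $\ell'$; (iii) $\ell'$ passes above two integer points $(i_1,j_1)$, $(i_2,j_2)$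 of $\ell$ with $i_1 \leq n/2 < i_2$. The sets $m(\ell)$, $\ell\in\mathcal{L}_n$, partition $A_n$, so each $w \in A_n$ lies in $m(\ell)$ for exactly one $\ell$. A word $w$ of length $n$ is said to go through the integer point $(i,j)$ ($0 \leq i,j \leq n$) if the number of letters $1$ among the first $i$ letters of $w$ equals $j$.
   Formalization: The lines $y = \alpha x + \rho$ with $\alpha, \rho \in (0,1)$ that define finite Sturmian words and witness membership in $m(\ell)$ have rational $\alpha$ and $\rho$ only. -}

module Defs where

open import Data.Nat using (ℕ; zero; suc; _+_; _*_; _∸_; _≤_; _<_; NonZero)
open import Data.Nat.DivMod using (_/_)
open import Data.Bool using (Bool; true; false)
open import Data.List using (List; []; _∷_; map; upTo; length; take; _++_)
open import Data.Product using (Σ; ∃; ∃-syntax; _×_; _,_)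
open import Data.Sum using (_⊎_)
open import Relation.Binary.PropositionalEquality using (_≡_)
open import Relation.Nullary using (¬_)

-- Binary words: true = letter 1, false = letter 0.
Word : Set
Word = List Bool

-- A line y = (slope/den) x + offset/den with rational parameters
-- (common positive denominator den).
record QLine : Set where
  constructor qline
  field
    slope offset den : ℕ
    {{den-nz}} : NonZero den
open QLine public

IsS : QLine → Set
IsS ℓ = (0 < slope ℓ) × (slope ℓ < den ℓ) × (0 < offset ℓ) × (offset ℓ < den ℓ)

floorAt : QLine → ℕ → ℕ
floorAt ℓ k = (k * slope ℓ + offset ℓ) / den ℓ

digit : ℕ → Bool
digit zero = false
digit (suc _) = true

-- a_k = ⌊(k+1)α+ρ⌋ - ⌊kα+ρ⌋   (which is 0 or 1 for α ∈ (0,1))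
letter : QLine → ℕ → Bool
letter ℓ k = digit (floorAt ℓ (suc k) ∸ floorAt ℓ k)

lineWord : QLine → ℕ → Word
lineWord ℓ n = map (letter ℓ) (upTo n)

Defines : QLine → Word → Set
Defines ℓ w = lineWord ℓ (length w) ≡ w

Sturmian : Word → Set
Sturmian w = ∃[ ℓ ] (IsS ℓ × Defines ℓ w)

OnLine : QLine → ℕ → ℕ → Set
OnLine ℓ i j = j * den ℓ ≡ i * slope ℓ + offset ℓ

Above : QLine → ℕ → ℕ → Set
Above ℓ i j = j * den ℓ < i * slope ℓ + offset ℓ

Below : QLine → ℕ → ℕ → Set
Below ℓ i j = i * slope ℓ + offset ℓ < j * den ℓ

Between : QLine → QLine → ℕ → ℕ → Set
Between ℓ ℓ' i j = (Above ℓ i j × Below ℓ' i j) ⊎ (Above ℓ' i j × Below ℓ i j)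

-- ℓ ∈ L_n : α, ρ ∈ [0,1] and Z_n(ℓ) ≥ 2
IsL : ℕ → QLine → Set
IsL n ℓ = (slope ℓ ≤ den ℓ) × (offset ℓ ≤ den ℓ) ×
  (∃[ i₁ ] ∃[ j₁ ] ∃[ i₂ ] ∃[ j₂ ]
     (i₁ < i₂ × i₂ ≤ n × OnLine ℓ i₁ j₁ × OnLine ℓ i₂ j₂))

InM : ℕ → QLine → Word → Set
InM n ℓ w = length w ≡ n × ∃[ ℓ' ]
  ( IsS ℓ' × Defines ℓ' w
  × (∀ i j → i ≤ n → j ≤ n → ¬ Between ℓ ℓ' i j)
  × (∃[ i₁ ] ∃[ j₁ ] ∃[ i₂ ] ∃[ j₂ ]
       ( OnLine ℓ i₁ j₁ × OnLine ℓ i₂ j₂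
       × 2 * i₁ ≤ n × n < 2 * i₂ × i₂ ≤ n
       × Above ℓ' i₁ j₁ × Above ℓ' i₂ j₂)))

ones : Word → ℕ
ones [] = 0
ones (true ∷ w) = suc (ones w)
ones (false ∷ w) = ones w

GoesThrough : Word → ℕ → ℕ → Set
GoesThrough w i j = ones (take i w) ≡ j

IsPrefix : Word → Word → Set
IsPrefix w w' = ∃[ v ] (w ++ v ≡ w')

{-# OPTIONS --safe #-}
-- Let w be defined by y = (a x + b)/d, and write fl x = ⌊(a x + b)/d⌋ and rem x for the
-- remainder, so that (x, fl x) lies on the level-(rem x) line y d + rem x = a x + b, and rem
-- is d-periodic. The line ℓ₁ of the least level m₁ carries a lattice point in every period,
-- and the line P₀ lying 1/(2d) above ℓ₁ has the same floors as ℓ₀ (all remainders are ≥ m₁)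
-- while no lattice point lies strictly between ℓ₁ and P₀. So the word w′ of P₀ of odd length
-- N = 2 i₁ + 1, for a lattice point (i₁, fl i₁) of ℓ₁ far enough out, extends w and lies in m(ℓ₁).
--
-- Conversely let w′ ∈ m(ℓ) be witnessed by P. Then ⌊P⌋ = fl on [0, N], so every lattice
-- point of ℓ is within 1 of the path of w′; every lattice point strictly under P is weakly
-- under a level line L (of level m₁, or of the next level m₂ when P = ℓ₁), and of two
-- consecutive lattice points of L one is strictly under P. This forces ℓ = L. If ℓ is
-- parallel to L and lower, two consecutive points of L lie between ℓ and P. Otherwise the
-- two points of ℓ given by (iii) are weakly under L and not both on it; if they are at least
-- 3d apart, two consecutive points of L between them lie strictly above ℓ, and if they are
-- closer, following ℓ for 3d such steps (still inside [0, N] since N ≥ 18 d²) moves it more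
-- than 2 away from fl.
-- Finally the lattice points of L are exactly the points (x, fl x) that w′ goes through.

module Submission where

open import Defs
open import Data.Nat using (ℕ; _≤_)
open import Data.List using (length)
open import Data.Product using (∃-syntax; _×_)

open import Data.Bool using (Bool; true; false)
open import Data.Empty using (⊥; ⊥-elim)
open import Data.List using ([]; _∷_; _++_; _∷ʳ_; map; take; drop; upTo; applyUpTo; filter)
open import Data.List.Properties using (applyUpTo-∷ʳ; map-upTo; map-cong; length-map; length-upTo; take++drop≡id)
open import Data.List.Membership.Propositional.Properties using (∈-filter⁺; ∈-filter⁻; ∈-upTo⁺; ∈-upTo⁻)
open import Data.List.Relation.Unary.All using (lookup)
import Data.List.Extrema as Extrema
open import Data.Nat
open import Data.Nat.DivMod
open import Data.Nat.Properties
open import Data.Nat.Tactic.RingSolver using (solve)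
open import Data.Product using (_,_; proj₁; proj₂)
open import Data.Sum using (_⊎_; inj₁; inj₂)
open import Data.Unit using (⊤; tt)
open import Function using (_∘_)
open import Relation.Binary.Definitions using (tri<; tri≈; tri>)
open import Relation.Binary.PropositionalEquality
open import Relation.Nullary using (¬_; yes; no)
open import Relation.Nullary.Decidable using (_×-dec_)
open import Relation.Unary using (Decidable)

[m*n+o]/n≡m : ∀ m n {o} .{{_ : NonZero n}} → o < n → (m * n + o) / n ≡ m
[m*n+o]/n≡m m n {o} o<n = begin
  (m * n + o) / n    ≡⟨ +-distrib-/ (m * n) o remainders<n ⟩
  m * n / n + o / n  ≡⟨ cong₂ _+_ (m*n/n≡m m n) (m<n⇒m/n≡0 o<n) ⟩
  m + 0              ≡⟨ +-identityʳ m ⟩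
  m                  ∎
  where
  open ≡-Reasoning
  remainders<n : m * n % n + o % n < n
  remainders<n = subst₂ (λ x y → x + y < n) (sym (m*n%n≡0 m n)) (sym (m<n⇒m%n≡m o<n)) o<n

m<[1+m/n]*n : ∀ m n .{{_ : NonZero n}} → m < suc (m / n) * n
m<[1+m/n]*n m n = begin-strict
  m                  ≡⟨ m≡m%n+[m/n]*n m n ⟩
  m % n + m / n * n  <⟨ +-monoˡ-< (m / n * n) (m%n<n m n) ⟩
  suc (m / n) * n    ∎
  where open ≤-Reasoning

+-≤-halves : ∀ x y {n} → 2 * x ≤ n → 2 * y ≤ n → x + y ≤ n
+-≤-halves x y {n} 2x≤n 2y≤n = *-cancelˡ-≤ 2 (begin
  2 * (x + y)    ≡⟨ *-distribˡ-+ 2 x y ⟩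
  2 * x + 2 * y  ≤⟨ +-mono-≤ 2x≤n 2y≤n ⟩
  n + n          ≡⟨ solve (n ∷ []) ⟩
  2 * n          ∎)
  where open ≤-Reasoning

2*-<-2*+1 : ∀ {x y} → x < y → 2 * x + 1 < 2 * y
2*-<-2*+1 {x} {y} x<y = begin-strict
  2 * x + 1    <⟨ +-monoʳ-< (2 * x) (n<1+n 1) ⟩
  2 * x + 2    ≡⟨ solve (x ∷ []) ⟩
  2 * suc x    ≤⟨ *-monoʳ-≤ 2 x<y ⟩
  2 * y        ∎
  where open ≤-Reasoning

x*[2a]+[2c+1]≡2[xa+c]+1 : ∀ x a c → x * (2 * a) + (2 * c + 1) ≡ 2 * (x * a + c) + 1
x*[2a]+[2c+1]≡2[xa+c]+1 x a c = solve (x ∷ a ∷ c ∷ [])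

m*n≢o : ∀ m {n o} → 0 < o → o < n → m * n ≢ o
m*n≢o zero    0<o _   m*n≡o = <-irrefl m*n≡o 0<o
m*n≢o (suc m) {n} _ o<n m*n≡o = <-irrefl refl (<-≤-trans o<n (subst (n ≤_) m*n≡o (m≤m+n n (m * n))))

<⇒2*≮2*+1 : ∀ {x y} → x < y → ¬ (2 * y < 2 * x + 1)
<⇒2*≮2*+1 x<y = <-asym (2*-<-2*+1 x<y)

-- Floors along rational lines

module _ (ℓ : QLine) where

  floorAt-≤-line : ∀ x → floorAt ℓ x * den ℓ ≤ x * slope ℓ + offset ℓ
  floorAt-≤-line x = m/n*n≤m (x * slope ℓ + offset ℓ) (den ℓ)

  line-<-suc-floorAt : ∀ x → x * slope ℓ + offset ℓ < suc (floorAt ℓ x) * den ℓ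
  line-<-suc-floorAt x = m<[1+m/n]*n (x * slope ℓ + offset ℓ) (den ℓ)

  Above⇒≤floorAt : ∀ x {y} → Above ℓ x y → y ≤ floorAt ℓ x
  Above⇒≤floorAt x {y} above =
    ≤-pred (*-cancelʳ-< (den ℓ) y (suc (floorAt ℓ x)) (<-trans above (line-<-suc-floorAt x)))

  floorAt-mono-suc : ∀ x → floorAt ℓ x ≤ floorAt ℓ (suc x)
  floorAt-mono-suc x = /-monoˡ-≤ (den ℓ) (+-monoˡ-≤ (offset ℓ) (m≤n+m (x * slope ℓ) (slope ℓ)))

  OnLine⇒≤suc : slope ℓ ≤ den ℓ → offset ℓ ≤ den ℓ → ∀ {x y} → OnLine ℓ x y → y ≤ suc x
  OnLine⇒≤suc slope≤ offset≤ {x} {y} on = *-cancelʳ-≤ y (suc x) (den ℓ) (begin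
    y * den ℓ                ≡⟨ on ⟩
    x * slope ℓ + offset ℓ   ≤⟨ +-mono-≤ (*-monoʳ-≤ x slope≤) offset≤ ⟩
    x * den ℓ + den ℓ        ≡⟨ +-comm (x * den ℓ) (den ℓ) ⟩
    suc x * den ℓ            ∎)
    where open ≤-Reasoning

  OnLine-monotone : ∀ {i₁ j₁ i₂ j₂} → i₁ ≤ i₂ → OnLine ℓ i₁ j₁ → OnLine ℓ i₂ j₂ → j₁ ≤ j₂
  OnLine-monotone {i₁} {j₁} {i₂} {j₂} i₁≤i₂ on₁ on₂ = *-cancelʳ-≤ j₁ j₂ (den ℓ) (begin
    j₁ * den ℓ                ≡⟨ on₁ ⟩
    i₁ * slope ℓ + offset ℓ   ≤⟨ +-monoˡ-≤ (offset ℓ) (*-monoˡ-≤ (slope ℓ) i₁≤i₂) ⟩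
    i₂ * slope ℓ + offset ℓ   ≡⟨ on₂ ⟨
    j₂ * den ℓ                ∎)
    where open ≤-Reasoning

  module _ (slope< : slope ℓ < den ℓ) (offset< : offset ℓ < den ℓ) where

    floorAt-≤ : ∀ x → floorAt ℓ x ≤ x
    floorAt-≤ x = ≤-pred (*-cancelʳ-< (den ℓ) (floorAt ℓ x) (suc x) (begin-strict
      floorAt ℓ x * den ℓ      ≤⟨ floorAt-≤-line x ⟩
      x * slope ℓ + offset ℓ   <⟨ +-mono-≤-< (*-monoʳ-≤ x (<⇒≤ slope<)) offset< ⟩
      x * den ℓ + den ℓ        ≡⟨ +-comm (x * den ℓ) (den ℓ) ⟩
      suc x * den ℓ            ∎))
      where open ≤-Reasoning

    floorAt-suc-≤ : ∀ x → floorAt ℓ (suc x) ≤ suc (floorAt ℓ x)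
    floorAt-suc-≤ x = ≤-pred (*-cancelʳ-< (den ℓ) (floorAt ℓ (suc x)) (suc (suc (floorAt ℓ x))) (begin-strict
      floorAt ℓ (suc x) * den ℓ            ≤⟨ floorAt-≤-line (suc x) ⟩
      suc x * slope ℓ + offset ℓ           ≡⟨ +-assoc (slope ℓ) (x * slope ℓ) (offset ℓ) ⟩
      slope ℓ + (x * slope ℓ + offset ℓ)   <⟨ +-mono-< slope< (line-<-suc-floorAt x) ⟩
      suc (suc (floorAt ℓ x)) * den ℓ      ∎))
      where open ≤-Reasoning

-- Words of lines

ones-++ : ∀ xs ys → ones (xs ++ ys) ≡ ones xs + ones ys
ones-++ []           ys = refl
ones-++ (true ∷ xs)  ys = cong suc (ones-++ xs ys)
ones-++ (false ∷ xs) ys = ones-++ xs ys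

+-ones-digit-∸ : ∀ {m n} → m ≤ n → n ≤ suc m → m + ones (digit (n ∸ m) ∷ []) ≡ n
+-ones-digit-∸ {m} {n} m≤n n≤1+m with m≤n⇒m<n∨m≡n n≤1+m
... | inj₂ refl rewrite m+n∸n≡m 1 m = +-comm m 1
... | inj₁ n<1+m rewrite ≤-antisym m≤n (≤-pred n<1+m) | n∸n≡0 n = +-identityʳ n

take-applyUpTo : ∀ (f : ℕ → Bool) {m n} → m ≤ n → take m (applyUpTo f n) ≡ applyUpTo f m
take-applyUpTo f {zero}  _         = refl
take-applyUpTo f {suc m} (s≤s m≤n) = cong (f 0 ∷_) (take-applyUpTo (f ∘ suc) m≤n)

length-lineWord : ∀ ℓ n → length (lineWord ℓ n) ≡ n
length-lineWord ℓ n = trans (length-map (letter ℓ) (upTo n)) (length-upTo n)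

take-lineWord : ∀ ℓ {m n} → m ≤ n → take m (lineWord ℓ n) ≡ lineWord ℓ m
take-lineWord ℓ {m} {n} m≤n = begin
  take m (map (letter ℓ) (upTo n))  ≡⟨ cong (take m) (map-upTo (letter ℓ) n) ⟩
  take m (applyUpTo (letter ℓ) n)   ≡⟨ take-applyUpTo (letter ℓ) m≤n ⟩
  applyUpTo (letter ℓ) m            ≡⟨ map-upTo (letter ℓ) m ⟨
  map (letter ℓ) (upTo m)           ∎
  where open ≡-Reasoning

module _ (ℓ : QLine) (slope< : slope ℓ < den ℓ) (offset< : offset ℓ < den ℓ) where

  ones-applyUpTo-letter : ∀ x → ones (applyUpTo (letter ℓ) x) ≡ floorAt ℓ x
  ones-applyUpTo-letter zero    = sym (m<n⇒m/n≡0 offset<)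
  ones-applyUpTo-letter (suc x) = begin
    ones (applyUpTo (letter ℓ) (suc x))                    ≡⟨ cong ones (applyUpTo-∷ʳ (letter ℓ) x) ⟨
    ones (applyUpTo (letter ℓ) x ∷ʳ letter ℓ x)            ≡⟨ ones-++ (applyUpTo (letter ℓ) x) (letter ℓ x ∷ []) ⟩
    ones (applyUpTo (letter ℓ) x) + ones (letter ℓ x ∷ []) ≡⟨ cong (_+ ones (letter ℓ x ∷ [])) (ones-applyUpTo-letter x) ⟩
    floorAt ℓ x + ones (letter ℓ x ∷ [])
      ≡⟨ +-ones-digit-∸ (floorAt-mono-suc ℓ x) (floorAt-suc-≤ ℓ slope< offset< x) ⟩
    floorAt ℓ (suc x)                                      ∎
    where open ≡-Reasoning

  lineWord-goesThrough-floorAt : ∀ {m n} → m ≤ n → GoesThrough (lineWord ℓ n) m (floorAt ℓ m)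
  lineWord-goesThrough-floorAt {m} {n} m≤n = begin
    ones (take m (lineWord ℓ n))   ≡⟨ cong ones (take-lineWord ℓ m≤n) ⟩
    ones (lineWord ℓ m)            ≡⟨ cong ones (map-upTo (letter ℓ) m) ⟩
    ones (applyUpTo (letter ℓ) m)  ≡⟨ ones-applyUpTo-letter m ⟩
    floorAt ℓ m                    ∎
    where open ≡-Reasoning

lineWord-cong : ∀ ℓ ℓ′ → (∀ x → floorAt ℓ x ≡ floorAt ℓ′ x) → ∀ n → lineWord ℓ n ≡ lineWord ℓ′ n
lineWord-cong ℓ ℓ′ same n = map-cong (λ k → cong₂ (λ p q → digit (p ∸ q)) (same (suc k)) (same k)) (upTo n)

NoPointBetween : ℕ → QLine → QLine → Set
NoPointBetween n ℓ ℓ′ = ∀ i j → i ≤ n → j ≤ n → ¬ Between ℓ ℓ′ i j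

module _ {n : ℕ} (ℓ P : QLine) (slope≤ : slope ℓ ≤ den ℓ) (offset≤ : offset ℓ ≤ den ℓ)
         (P-slope< : slope P < den P) (P-offset< : offset P < den P) (empty : NoPointBetween n ℓ P) where

  OnLine⇒≤suc-floorAt : ∀ {x y} → x ≤ n → OnLine ℓ x y → y ≤ suc (floorAt P x)
  OnLine⇒≤suc-floorAt {x} {zero}  _   _  = z≤n
  OnLine⇒≤suc-floorAt {x} {suc y} x≤n on with y ≤? floorAt P x
  ... | yes y≤ = s≤s y≤
  ... | no y≰ = ⊥-elim (empty x y x≤n y≤n (inj₁ (ℓ-above , P-below)))
    where
    y≤n = ≤-trans (≤-pred (OnLine⇒≤suc ℓ slope≤ offset≤ on)) x≤n
    ℓ-above : Above ℓ x y
    ℓ-above = subst (y * den ℓ <_) on (m<n+m (y * den ℓ) (>-nonZero⁻¹ (den ℓ)))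
    P-below : Below P x y
    P-below = <-≤-trans (line-<-suc-floorAt P x) (*-monoˡ-≤ (den P) (≰⇒> y≰))

  OnLine⇒floorAt≤suc : ∀ {x y} → x ≤ n → OnLine ℓ x y → floorAt P x ≤ suc y
  OnLine⇒floorAt≤suc {x} {y} x≤n on with floorAt P x ≤? suc y
  ... | yes fl≤ = fl≤
  ... | no fl≰ = ⊥-elim (empty x (suc y) x≤n 1+y≤n (inj₂ (P-above , ℓ-below)))
    where
    1+y<fl = ≰⇒> fl≰
    1+y≤n = ≤-trans (<⇒≤ 1+y<fl) (≤-trans (floorAt-≤ P P-slope< P-offset< x) x≤n)
    P-above : Above P x (suc y)
    P-above = <-≤-trans (*-monoˡ-< (den P) 1+y<fl) (floorAt-≤-line P x)
    ℓ-below : Below ℓ x (suc y)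
    ℓ-below = subst (_< suc y * den ℓ) on (m<n+m (y * den ℓ) (>-nonZero⁻¹ (den ℓ)))

module _ {P : ℕ → Set} (P? : Decidable P) (f : ℕ → ℕ) where
  open Extrema ≤-totalOrder

  minimiser-below : ∀ {n c} → c < n → P c → ∃[ z ] (z < n × P z × (∀ {y} → y < n → P y → f z ≤ f y))
  minimiser-below {n} {c} c<n Pc = z , proj₁ admissible , proj₂ admissible , minimal
    where
    candidates = filter P? (upTo n)
    z = argmin f c candidates
    admissible : z < n × P z
    admissible with argmin-sel f c candidates
    ... | inj₁ z≡c = subst (λ x → x < n × P x) (sym z≡c) (c<n , Pc)
    ... | inj₂ z∈ = let (z∈upTo , Pz) = ∈-filter⁻ P? z∈ in ∈-upTo⁻ z∈upTo , Pz
    minimal : ∀ {y} → y < n → P y → f z ≤ f y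
    minimal y<n Py = lookup (f[argmin]≤f[xs] c candidates) (∈-filter⁺ P? (∈-upTo⁺ y<n) Py)

-- Levels of a reference line

module Reference (a b d : ℕ) {{d≢0 : NonZero d}} where

  ℓ₀ : QLine
  ℓ₀ = qline a b d

  fl : ℕ → ℕ
  fl = floorAt ℓ₀

  rem : ℕ → ℕ
  rem x = (x * a + b) % d

  fl*d+rem : ∀ x → fl x * d + rem x ≡ x * a + b
  fl*d+rem x = trans (+-comm (fl x * d) (rem x)) (sym (m≡m%n+[m/n]*n (x * a + b) d))

  rem<d : ∀ x → rem x < d
  rem<d x = m%n<n (x * a + b) d

  rem-periodic : ∀ x k → rem (x + k * d) ≡ rem x
  rem-periodic x k = trans (cong (_% d) expand) ([m+kn]%n≡m%n (x * a + b) (k * a) d)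
    where
    expand : (x + k * d) * a + b ≡ x * a + b + k * a * d
    expand = solve (x ∷ k ∷ d ∷ a ∷ b ∷ [])

  rem≡rem[x%d] : ∀ x → rem x ≡ rem (x % d)
  rem≡rem[x%d] x = trans (cong rem (m≡m%n+[m/n]*n x d)) (rem-periodic (x % d) (x / d))

  OnLevel : ℕ → ℕ → ℕ → Set
  OnLevel m x y = y * d + m ≡ x * a + b

  next-level-point : ∀ x k → x + k * d + d ≡ x + suc k * d
  next-level-point x k = solve (x ∷ k ∷ d ∷ [])

  OnLevel-rem : ∀ x k → OnLevel (rem x) (x + k * d) (fl (x + k * d))
  OnLevel-rem x k = subst (λ m → OnLevel m (x + k * d) (fl (x + k * d))) (rem-periodic x k) (fl*d+rem (x + k * d))

  OnLevel⇒≡fl : ∀ {m} x y → m < d → OnLevel m x y → y ≡ fl x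
  OnLevel⇒≡fl {m} x y m<d on = trans (sym ([m*n+o]/n≡m y d m<d)) (cong (_/ d) on)

  level-line-through : ∀ p r D {{_ : NonZero D}} m x x′ y y′ → x + d ≡ x′ →
    OnLevel m x y → OnLevel m x′ y′ → OnLine (qline p r D) x y → OnLine (qline p r D) x′ y′ →
    a * D ≡ p * d × r * d + m * D ≡ b * D
  level-line-through p r D m x x′ y y′ refl lev lev′ on on′ = aD≡pd , rd+mD≡bD
    where
    open ≡-Reasoning
    y′≡y+a : y′ ≡ y + a
    y′≡y+a = *-cancelʳ-≡ y′ (y + a) d (+-cancelʳ-≡ m _ _ (begin
      y′ * d + m         ≡⟨ lev′ ⟩
      (x + d) * a + b    ≡⟨ solve (x ∷ d ∷ a ∷ b ∷ []) ⟩
      x * a + b + a * d  ≡⟨ cong (_+ a * d) lev ⟨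
      y * d + m + a * d  ≡⟨ solve (y ∷ d ∷ m ∷ a ∷ []) ⟩
      (y + a) * d + m    ∎))
    aD≡pd : a * D ≡ p * d
    aD≡pd = sym (+-cancelˡ-≡ (x * p + r) _ _ (begin
      x * p + r + p * d  ≡⟨ solve (x ∷ p ∷ r ∷ d ∷ []) ⟩
      (x + d) * p + r    ≡⟨ on′ ⟨
      y′ * D             ≡⟨ cong (_* D) y′≡y+a ⟩
      (y + a) * D        ≡⟨ *-distribʳ-+ D y a ⟩
      y * D + a * D      ≡⟨ cong (_+ a * D) on ⟩
      x * p + r + a * D  ∎))
    rd+mD≡bD : r * d + m * D ≡ b * D
    rd+mD≡bD = +-cancelˡ-≡ (x * (a * D)) _ _ (begin
      x * (a * D) + (r * d + m * D)  ≡⟨ cong (λ t → x * t + (r * d + m * D)) aD≡pd ⟩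
      x * (p * d) + (r * d + m * D)  ≡⟨ solve (x ∷ p ∷ d ∷ r ∷ m ∷ D ∷ []) ⟩
      (x * p + r) * d + m * D        ≡⟨ cong (λ t → t * d + m * D) on ⟨
      y * D * d + m * D              ≡⟨ solve (y ∷ D ∷ d ∷ m ∷ []) ⟩
      (y * d + m) * D                ≡⟨ cong (_* D) lev ⟩
      (x * a + b) * D                ≡⟨ solve (x ∷ a ∷ b ∷ D ∷ []) ⟩
      x * (a * D) + b * D            ∎)

  module LevelLine (s o e : ℕ) {{e≢0 : NonZero e}} (c : ℕ) (ae≡sd : a * e ≡ s * d) (od+ce≡be : o * d + c * e ≡ b * e) where

    scaled : ∀ x → (x * s + o) * d + c * e ≡ (x * a + b) * e
    scaled x = begin
      (x * s + o) * d + c * e        ≡⟨ solve (x ∷ s ∷ o ∷ d ∷ c ∷ e ∷ []) ⟩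
      x * (s * d) + (o * d + c * e)  ≡⟨ cong₂ (λ p q → x * p + q) (sym ae≡sd) od+ce≡be ⟩
      x * (a * e) + b * e            ≡⟨ solve (x ∷ a ∷ e ∷ b ∷ []) ⟩
      (x * a + b) * e                ∎
      where open ≡-Reasoning

    scaled-point : ∀ y → (y * d + c) * e ≡ (y * e) * d + c * e
    scaled-point y = solve (y ∷ d ∷ c ∷ e ∷ [])

    OnLine⇒OnLevel : ∀ x y → OnLine (qline s o e) x y → OnLevel c x y
    OnLine⇒OnLevel x y on = *-cancelʳ-≡ (y * d + c) (x * a + b) e (begin
      (y * d + c) * e          ≡⟨ scaled-point y ⟩
      (y * e) * d + c * e      ≡⟨ cong (λ p → p * d + c * e) on ⟩
      (x * s + o) * d + c * e  ≡⟨ scaled x ⟩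
      (x * a + b) * e          ∎)
      where open ≡-Reasoning

    Above⇒above-level : ∀ x y → Above (qline s o e) x y → y * d + c < x * a + b
    Above⇒above-level x y above = *-cancelʳ-< e (y * d + c) (x * a + b) (begin-strict
      (y * d + c) * e          ≡⟨ scaled-point y ⟩
      (y * e) * d + c * e      <⟨ +-monoˡ-< (c * e) (*-monoˡ-< d above) ⟩
      (x * s + o) * d + c * e  ≡⟨ scaled x ⟩
      (x * a + b) * e          ∎)
      where open ≤-Reasoning

    above-level⇒Above : ∀ x y → y * d + c < x * a + b → Above (qline s o e) x y
    above-level⇒Above x y above = *-cancelʳ-< d (y * e) (x * s + o) (+-cancelʳ-< (c * e) _ _ (begin-strict
      (y * e) * d + c * e      ≡⟨ scaled-point y ⟨
      (y * d + c) * e          <⟨ *-monoˡ-< e above ⟩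
      (x * a + b) * e          ≡⟨ scaled x ⟨
      (x * s + o) * d + c * e  ∎))
      where open ≤-Reasoning

    below-level⇒Below : ∀ x y → x * a + b < y * d + c → Below (qline s o e) x y
    below-level⇒Below x y below = *-cancelʳ-< d (x * s + o) (y * e) (+-cancelʳ-< (c * e) _ _ (begin-strict
      (x * s + o) * d + c * e  ≡⟨ scaled x ⟩
      (x * a + b) * e          <⟨ *-monoˡ-< e below ⟩
      (y * d + c) * e          ≡⟨ scaled-point y ⟩
      (y * e) * d + c * e      ∎))
      where open ≤-Reasoning

  fl-drift-up : ∀ x h r → r * d < h * a → fl x + 3 * d * r + 2 < fl (x + 3 * d * h)
  fl-drift-up x h r rd<ha = *-cancelʳ-< d _ _ (+-cancelʳ-< d _ _ (begin-strict
    (fl x + 3 * d * r + 2) * d + d      ≡⟨ regroup (fl x) ⟩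
    fl x * d + 3 * d * suc (r * d)      ≤⟨ +-mono-≤ (m≤m+n (fl x * d) (rem x)) (*-monoʳ-≤ (3 * d) rd<ha) ⟩
    fl x * d + rem x + 3 * d * (h * a)  ≡⟨ cong (_+ 3 * d * (h * a)) (fl*d+rem x) ⟩
    x * a + b + 3 * d * (h * a)         ≡⟨ solve (x ∷ a ∷ b ∷ d ∷ h ∷ []) ⟩
    (x + 3 * d * h) * a + b             ≡⟨ fl*d+rem z ⟨
    fl z * d + rem z                    <⟨ +-monoʳ-< (fl z * d) (rem<d z) ⟩
    fl z * d + d                        ∎))
    where
    open ≤-Reasoning
    z = x + 3 * d * h
    regroup : ∀ F → (F + 3 * d * r + 2) * d + d ≡ F * d + 3 * d * suc (r * d)
    regroup F = solve (F ∷ d ∷ r ∷ [])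

  fl-drift-down : ∀ x h r → h * a < r * d → fl (x + 3 * d * h) + 2 < fl x + 3 * d * r
  fl-drift-down x h r ha<rd = *-cancelʳ-< d _ _ (+-cancelʳ-< d _ _ (begin-strict
    (fl z + 2) * d + d                  ≡⟨ regroup (fl z) ⟩
    fl z * d + 3 * d                    ≤⟨ +-monoˡ-≤ (3 * d) (m≤m+n (fl z * d) (rem z)) ⟩
    fl z * d + rem z + 3 * d            ≡⟨ cong (_+ 3 * d) (fl*d+rem z) ⟩
    (x + 3 * d * h) * a + b + 3 * d     ≡⟨ solve (x ∷ d ∷ h ∷ a ∷ b ∷ []) ⟩
    x * a + b + 3 * d * suc (h * a)     ≤⟨ +-monoʳ-≤ (x * a + b) (*-monoʳ-≤ (3 * d) ha<rd) ⟩
    x * a + b + 3 * d * (r * d)         ≡⟨ cong (_+ 3 * d * (r * d)) (fl*d+rem x) ⟨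
    fl x * d + rem x + 3 * d * (r * d)  <⟨ +-monoˡ-< (3 * d * (r * d)) (+-monoʳ-< (fl x * d) (rem<d x)) ⟩
    fl x * d + d + 3 * d * (r * d)      ≡⟨ regroup′ (fl x) ⟩
    (fl x + 3 * d * r) * d + d          ∎))
    where
    open ≤-Reasoning
    z = x + 3 * d * h
    regroup : ∀ F → (F + 2) * d + d ≡ F * d + 3 * d
    regroup F = solve (F ∷ d ∷ [])
    regroup′ : ∀ F → F * d + d + 3 * d * (r * d) ≡ (F + 3 * d * r) * d + d
    regroup′ F = solve (F ∷ d ∷ r ∷ [])

  module Rigidity
    (N : ℕ) (N-large : 18 * (d * d) ≤ N)
    (P : QLine) (P-slope< : slope P < den P) (P-offset< : offset P < den P)
    (floorAt-P : ∀ {x} → x ≤ N → floorAt P x ≡ fl x)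
    (m z₀ : ℕ) (m<d : m < d) (z₀<d : z₀ < d)
    (level : ∀ k → OnLevel m (z₀ + k * d) (fl (z₀ + k * d)))
    (under-level : ∀ i j → i ≤ N → Above P i j → j * d + m ≤ i * a + b)
    (P-above-level : ∀ k → z₀ + suc k * d ≤ N →
      Above P (z₀ + k * d) (fl (z₀ + k * d)) ⊎ Above P (z₀ + suc k * d) (fl (z₀ + suc k * d)))
    (s o e : ℕ) {{e≢0 : NonZero e}} (slope≤ : s ≤ e) (offset≤ : o ≤ e)
    (empty : NoPointBetween N (qline s o e) P)
    where

    ℓ : QLine
    ℓ = qline s o e

    fl≤N : ∀ {x} → x ≤ N → fl x ≤ N
    fl≤N {x} x≤N = subst (_≤ N) (floorAt-P x≤N) (≤-trans (floorAt-≤ P P-slope< P-offset< x) x≤N)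

    OnLine⇒≤suc-fl : ∀ {x y} → x ≤ N → OnLine ℓ x y → y ≤ suc (fl x)
    OnLine⇒≤suc-fl {x} {y} x≤N on =
      subst (λ f → y ≤ suc f) (floorAt-P x≤N) (OnLine⇒≤suc-floorAt ℓ P slope≤ offset≤ P-slope< P-offset< empty x≤N on)

    OnLine⇒fl≤suc : ∀ {x} y → x ≤ N → OnLine ℓ x y → fl x ≤ suc y
    OnLine⇒fl≤suc {x} y x≤N on =
      subst (_≤ suc y) (floorAt-P x≤N) (OnLine⇒floorAt≤suc ℓ P slope≤ offset≤ P-slope< P-offset< empty x≤N on)

    level-points-not-both-above-ℓ : ∀ k → z₀ + suc k * d ≤ N →
      Below ℓ (z₀ + k * d) (fl (z₀ + k * d)) → Below ℓ (z₀ + suc k * d) (fl (z₀ + suc k * d)) → ⊥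
    level-points-not-both-above-ℓ k in-range below below′ with P-above-level k in-range
    ... | inj₁ above  = empty _ _ z≤N (fl≤N z≤N) (inj₂ (above , below))
      where z≤N = ≤-trans (+-monoʳ-≤ z₀ (m≤n+m (k * d) d)) in-range
    ... | inj₂ above′ = empty _ _ in-range (fl≤N in-range) (inj₂ (above′ , below′))

    level-above-chord : ∀ {i i′ g g′} j j′ z y → i < z → z < i′ → 0 < g ⊎ 0 < g′ →
      OnLine ℓ i j → OnLine ℓ i′ j′ → j * d + m + g ≡ i * a + b → j′ * d + m + g′ ≡ i′ * a + b →
      OnLevel m z y → Below ℓ z y
    -- ℓ and the level line are both affine: interpolating their gaps at i and i′ with weights
    -- v = i′ − z and u = z − i gives a positive gap at z.
    level-above-chord {i} {i′} {g} {g′} j j′ z y i<z z<i′ gaps on on′ lev lev′ on-level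
      with (u , refl) ← m≤n⇒∃[o]m+o≡n {suc i} {z} i<z
      with (v , refl) ← m≤n⇒∃[o]m+o≡n {suc (suc i + u)} {i′} z<i′ =
      *-cancelʳ-< (suc u + suc v) (suc (i + u) * s + o) (y * e) (begin-strict
        (suc (i + u) * s + o) * (suc u + suc v)                   ≡⟨ solve (i ∷ u ∷ v ∷ s ∷ o ∷ []) ⟩
        suc v * (i * s + o) + suc u * ((suc (suc i + u) + v) * s + o)  ≡⟨ cong₂ (λ p q → suc v * p + suc u * q) on on′ ⟨
        suc v * (j * e) + suc u * (j′ * e)                         ≡⟨ solve (v ∷ j ∷ e ∷ u ∷ j′ ∷ []) ⟩
        (suc v * j + suc u * j′) * e                               <⟨ *-monoˡ-< e chord<y ⟩
        (suc u + suc v) * y * e                                    ≡⟨ solve (u ∷ v ∷ y ∷ e ∷ []) ⟩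
        y * e * (suc u + suc v)                                    ∎)
      where
      open ≤-Reasoning
      weighted-gap : 0 < g ⊎ 0 < g′ → 0 < suc v * g + suc u * g′
      weighted-gap (inj₁ 0<g)  = ≤-trans (*-mono-≤ (s≤s (z≤n {v})) 0<g) (m≤m+n (suc v * g) (suc u * g′))
      weighted-gap (inj₂ 0<g′) = ≤-trans (*-mono-≤ (s≤s (z≤n {u})) 0<g′) (m≤n+m (suc u * g′) (suc v * g))
      chord<y : suc v * j + suc u * j′ < (suc u + suc v) * y
      chord<y = *-cancelʳ-< d _ _ (+-cancelʳ-< ((suc u + suc v) * m) _ _ (begin-strict
        (suc v * j + suc u * j′) * d + (suc u + suc v) * m        <⟨ m<m+n _ (weighted-gap gaps) ⟩
        (suc v * j + suc u * j′) * d + (suc u + suc v) * m + (suc v * g + suc u * g′)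
                                                                   ≡⟨ solve (v ∷ j ∷ u ∷ j′ ∷ d ∷ m ∷ g ∷ g′ ∷ []) ⟩
        suc v * (j * d + m + g) + suc u * (j′ * d + m + g′)       ≡⟨ cong₂ (λ p q → suc v * p + suc u * q) lev lev′ ⟩
        suc v * (i * a + b) + suc u * ((suc (suc i + u) + v) * a + b)  ≡⟨ solve (v ∷ i ∷ a ∷ b ∷ u ∷ []) ⟩
        (suc u + suc v) * (suc (i + u) * a + b)                   ≡⟨ cong ((suc u + suc v) *_) on-level ⟨
        (suc u + suc v) * (y * d + m)                              ≡⟨ solve (u ∷ v ∷ y ∷ d ∷ m ∷ []) ⟩
        (suc u + suc v) * y * d + (suc u + suc v) * m              ∎))

    module Chord (i j h r : ℕ) (0<h : 0 < h) (2i≤N : 2 * i ≤ N) (i+h≤N : i + h ≤ N)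
      (on : OnLine ℓ i j) (on′ : OnLine ℓ (i + h) (j + r))
      (g g′ : ℕ) (lev : j * d + m + g ≡ i * a + b) (lev′ : (j + r) * d + m + g′ ≡ (i + h) * a + b)
      where

      i≤N : i ≤ N
      i≤N = ≤-trans (m≤m+n i h) i+h≤N

      r*e≡h*s : r * e ≡ h * s
      r*e≡h*s = +-cancelˡ-≡ (j * e) _ _ (begin
        j * e + r * e        ≡⟨ *-distribʳ-+ e j r ⟨
        (j + r) * e          ≡⟨ on′ ⟩
        (i + h) * s + o      ≡⟨ solve (i ∷ h ∷ s ∷ o ∷ []) ⟩
        (i * s + o) + h * s  ≡⟨ cong (_+ h * s) on ⟨
        j * e + h * s        ∎)
        where open ≡-Reasoning

      parallel : h * a ≡ r * d → a * e ≡ s * d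
      parallel ha≡rd = *-cancelˡ-≡ (a * e) (s * d) h {{>-nonZero 0<h}} (begin
        h * (a * e)  ≡⟨ *-assoc h a e ⟨
        h * a * e    ≡⟨ cong (_* e) ha≡rd ⟩
        r * d * e    ≡⟨ solve (r ∷ d ∷ e ∷ []) ⟩
        r * e * d    ≡⟨ cong (_* d) r*e≡h*s ⟩
        h * s * d    ≡⟨ *-assoc h s d ⟩
        h * (s * d)  ∎)
        where open ≡-Reasoning

      offset-of-ℓ : a * e ≡ s * d → o * d + (m + g) * e ≡ b * e
      offset-of-ℓ ae≡sd = +-cancelˡ-≡ (i * (s * d)) _ _ (begin
        i * (s * d) + (o * d + (m + g) * e)  ≡⟨ solve (i ∷ s ∷ d ∷ o ∷ m ∷ g ∷ e ∷ []) ⟩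
        (i * s + o) * d + (m + g) * e        ≡⟨ cong (λ p → p * d + (m + g) * e) on ⟨
        j * e * d + (m + g) * e              ≡⟨ solve (j ∷ e ∷ d ∷ m ∷ g ∷ []) ⟩
        (j * d + m + g) * e                  ≡⟨ cong (_* e) lev ⟩
        (i * a + b) * e                      ≡⟨ solve (i ∷ a ∷ b ∷ e ∷ []) ⟩
        i * (a * e) + b * e                  ≡⟨ cong (λ p → i * p + b * e) ae≡sd ⟩
        i * (s * d) + b * e                  ∎)
        where open ≡-Reasoning

      parallel-contradiction : a * e ≡ s * d → 0 < g → ⊥
      parallel-contradiction ae≡sd 0<g = level-points-not-both-above-ℓ 0 z₀+d≤N (level-above-ℓ 0) (level-above-ℓ 1)
        where
        open LevelLine s o e (m + g) ae≡sd (offset-of-ℓ ae≡sd)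
        level-above-ℓ : ∀ k → Below ℓ (z₀ + k * d) (fl (z₀ + k * d))
        level-above-ℓ k = below-level⇒Below (z₀ + k * d) (fl (z₀ + k * d))
          (subst (_< fl (z₀ + k * d) * d + (m + g)) (level k) (+-monoʳ-< (fl (z₀ + k * d) * d) (m<m+n m 0<g)))
        z₀+d≤N : z₀ + 1 * d ≤ N
        z₀+d≤N = ≤-trans (+-mono-≤ (<⇒≤ z₀<d) (≤-reflexive (*-identityˡ d))) (begin
          d + d          ≡⟨ solve (d ∷ []) ⟩
          2 * d          ≤⟨ *-monoʳ-≤ 2 (m≤m*n d d) ⟩
          2 * (d * d)    ≤⟨ *-monoˡ-≤ (d * d) (m≤m+n 2 16) ⟩
          18 * (d * d)   ≤⟨ N-large ⟩
          N              ∎)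
          where open ≤-Reasoning

      some-gap : h * a ≢ r * d → 0 < g ⊎ 0 < g′
      some-gap ha≢rd with 0 <? g | 0 <? g′
      ... | yes 0<g | _        = inj₁ 0<g
      ... | no _    | yes 0<g′ = inj₂ 0<g′
      ... | no g≯0  | no g′≯0  = ⊥-elim (ha≢rd (sym (+-cancelˡ-≡ (j * d + m + g) _ _ (begin
        j * d + m + g + r * d   ≡⟨ solve (j ∷ d ∷ m ∷ g ∷ r ∷ []) ⟩
        (j + r) * d + m + g     ≡⟨ cong ((j + r) * d + m +_) (trans g≡0 (sym g′≡0)) ⟩
        (j + r) * d + m + g′    ≡⟨ lev′ ⟩
        (i + h) * a + b         ≡⟨ solve (i ∷ h ∷ a ∷ b ∷ []) ⟩
        i * a + b + h * a       ≡⟨ cong (_+ h * a) lev ⟨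
        j * d + m + g + h * a   ∎))))
        where
        open ≡-Reasoning
        g≡0 = n≤0⇒n≡0 (≮⇒≥ g≯0)
        g′≡0 = n≤0⇒n≡0 (≮⇒≥ g′≯0)

      interior-contradiction : 0 < g ⊎ 0 < g′ → 3 * d ≤ h → ⊥
      interior-contradiction gaps 3d≤h = level-points-not-both-above-ℓ (suc q) (≤-trans (<⇒≤ z₂<i+h) i+h≤N)
        (level-above-chord j (j + r) z₁ (fl z₁) i<z₁ (<-trans z₁<z₂ z₂<i+h) gaps on on′ lev lev′ (level (suc q)))
        (level-above-chord j (j + r) z₂ (fl z₂) (<-trans i<z₁ z₁<z₂) z₂<i+h gaps on on′ lev lev′ (level (suc (suc q))))
        where
        open ≤-Reasoning
        q = i / d
        z₁ = z₀ + suc q * d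
        z₂ = z₀ + suc (suc q) * d
        i<z₁ : i < z₁
        i<z₁ = begin-strict
          i                  ≡⟨ m≡m%n+[m/n]*n i d ⟩
          i % d + q * d      <⟨ +-monoˡ-< (q * d) (m%n<n i d) ⟩
          suc q * d          ≤⟨ m≤n+m (suc q * d) z₀ ⟩
          z₁                 ∎
        z₁<z₂ : z₁ < z₂
        z₁<z₂ = +-monoʳ-< z₀ (*-monoˡ-< d (n<1+n (suc q)))
        regroup : ∀ q → d + suc (suc q) * d ≡ 3 * d + q * d
        regroup q = solve (q ∷ d ∷ [])
        z₂<i+h : z₂ < i + h
        z₂<i+h = begin-strict
          z₀ + suc (suc q) * d  <⟨ +-monoˡ-< (suc (suc q) * d) z₀<d ⟩
          d + suc (suc q) * d   ≡⟨ regroup q ⟩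
          3 * d + q * d         ≤⟨ +-mono-≤ 3d≤h (m≤n+m (q * d) (i % d)) ⟩
          h + (i % d + q * d)   ≡⟨ cong (h +_) (m≡m%n+[m/n]*n i d) ⟨
          h + i                 ≡⟨ +-comm h i ⟩
          i + h                 ∎

      far = i + 3 * d * h

      far≤N : h < 3 * d → far ≤ N
      far≤N h<3d = +-≤-halves i (3 * d * h) 2i≤N (begin
        2 * (3 * d * h)        ≤⟨ *-monoʳ-≤ 2 (*-monoʳ-≤ (3 * d) (<⇒≤ h<3d)) ⟩
        2 * (3 * d * (3 * d))  ≡⟨ solve (d ∷ []) ⟩
        18 * (d * d)           ≤⟨ N-large ⟩
        N                      ∎)
        where open ≤-Reasoning

      on-far : OnLine ℓ far (j + 3 * d * r)
      on-far = begin
        (j + 3 * d * r) * e          ≡⟨ solve (j ∷ d ∷ r ∷ e ∷ []) ⟩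
        j * e + 3 * d * (r * e)      ≡⟨ cong₂ (λ p q → p + 3 * d * q) on r*e≡h*s ⟩
        i * s + o + 3 * d * (h * s)  ≡⟨ solve (i ∷ s ∷ o ∷ d ∷ h ∷ []) ⟩
        (i + 3 * d * h) * s + o      ∎
        where open ≡-Reasoning

      drift-contradiction : h * a ≢ r * d → h < 3 * d → ⊥
      drift-contradiction ha≢rd h<3d with <-cmp (h * a) (r * d)
      ... | tri≈ _ ha≡rd _ = ha≢rd ha≡rd
      ... | tri> _ _ rd<ha = <-irrefl refl (<-≤-trans (fl-drift-up i h r rd<ha) (begin
        fl far                     ≤⟨ OnLine⇒fl≤suc (j + 3 * d * r) (far≤N h<3d) on-far ⟩
        suc (j + 3 * d * r)        ≤⟨ s≤s (+-monoˡ-≤ (3 * d * r) (OnLine⇒≤suc-fl i≤N on)) ⟩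
        2 + (fl i + 3 * d * r)     ≡⟨ +-comm 2 (fl i + 3 * d * r) ⟩
        fl i + 3 * d * r + 2       ∎))
        where open ≤-Reasoning
      ... | tri< ha<rd _ _ = <-irrefl refl (<-≤-trans (fl-drift-down i h r ha<rd) (begin
        fl i + 3 * d * r           ≤⟨ +-monoˡ-≤ (3 * d * r) (OnLine⇒fl≤suc j i≤N on) ⟩
        suc (j + 3 * d * r)        ≤⟨ s≤s (OnLine⇒≤suc-fl (far≤N h<3d) on-far) ⟩
        2 + fl far                 ≡⟨ +-comm 2 (fl far) ⟩
        fl far + 2                 ∎))
        where open ≤-Reasoning

      chord-rigid : ∀ x y → OnLine ℓ x y → y ≡ fl x
      chord-rigid x y on-xy with h * a ≟ r * d | g ≟ 0
      ... | yes ha≡rd | yes g≡0 = OnLevel⇒≡fl x y m+g<d (OnLine⇒OnLevel x y on-xy)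
        where
        open LevelLine s o e (m + g) (parallel ha≡rd) (offset-of-ℓ (parallel ha≡rd))
        m+g<d = ≤-<-trans (≤-reflexive (trans (cong (m +_) g≡0) (+-identityʳ m))) m<d
      ... | yes ha≡rd | no g≢0 = ⊥-elim (parallel-contradiction (parallel ha≡rd) (n≢0⇒n>0 g≢0))
      ... | no ha≢rd  | _ with 3 * d ≤? h
      ...   | yes 3d≤h = ⊥-elim (interior-contradiction (some-gap ha≢rd) 3d≤h)
      ...   | no 3d≰h  = ⊥-elim (drift-contradiction ha≢rd (≰⇒> 3d≰h))

    rigid : ∀ i₁ j₁ i₂ j₂ → OnLine ℓ i₁ j₁ → OnLine ℓ i₂ j₂ → 2 * i₁ ≤ N → N < 2 * i₂ → i₂ ≤ N →
      Above P i₁ j₁ → Above P i₂ j₂ → ∀ x y → OnLine ℓ x y → y ≡ fl x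
    rigid i₁ j₁ i₂ j₂ on₁ on₂ 2i₁≤N N<2i₂ i₂≤N above₁ above₂
      with i₁<i₂ ← *-cancelˡ-< 2 i₁ i₂ (≤-<-trans 2i₁≤N N<2i₂)
      with (h , refl) ← m≤n⇒∃[o]m+o≡n {i₁} {i₂} (<⇒≤ i₁<i₂)
         | (r , refl) ← m≤n⇒∃[o]m+o≡n {j₁} {j₂} (OnLine-monotone ℓ (<⇒≤ i₁<i₂) on₁ on₂) =
      Chord.chord-rigid i₁ j₁ h r 0<h 2i₁≤N i₂≤N on₁ on₂ _ _
        (m+[n∸m]≡n (under-level i₁ j₁ (≤-trans (m≤m+n i₁ h) i₂≤N) above₁))
        (m+[n∸m]≡n (under-level (i₁ + h) (j₁ + r) i₂≤N above₂))
      where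
      0<h : 0 < h
      0<h = +-cancelˡ-< i₁ 0 h (subst (_< i₁ + h) (sym (+-identityʳ i₁)) i₁<i₂)

-- The extension of w

module Extension (a b d : ℕ) {{d≢0 : NonZero d}} (0<a : 0 < a) (a<d : a < d) (b<d : b < d) (n : ℕ) where

  open Reference a b d

  instance
    2d≢0 : NonZero (2 * d)
    2d≢0 = m*n≢0 2 d

  -- Opaque: letting unification unfold the list search makes type checking blow up.
  opaque
    lowest : ∃[ z ] (z < d × ⊤ × (∀ {y} → y < d → ⊤ → rem z ≤ rem y))
    lowest = minimiser-below {P = λ _ → ⊤} (λ _ → yes tt) rem (>-nonZero⁻¹ d) tt

  z₁ : ℕ
  z₁ = proj₁ lowest

  m₁ : ℕ
  m₁ = rem z₁

  m₁≤rem : ∀ x → m₁ ≤ rem x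
  m₁≤rem x = subst (m₁ ≤_) (sym (rem≡rem[x%d] x)) (proj₂ (proj₂ (proj₂ lowest)) (m%n<n x d) tt)

  m₁≤b : m₁ ≤ b
  m₁≤b = subst (m₁ ≤_) (m<n⇒m%n≡m b<d) (m₁≤rem 0)

  c : ℕ
  c = b ∸ m₁

  ℓ₁ : QLine
  ℓ₁ = qline a c d

  OnLevel⇒OnLine-ℓ₁ : ∀ x y → OnLevel m₁ x y → OnLine ℓ₁ x y
  OnLevel⇒OnLine-ℓ₁ x y lev = +-cancelʳ-≡ m₁ (y * d) (x * a + c) (begin
    y * d + m₁        ≡⟨ lev ⟩
    x * a + b         ≡⟨ cong (x * a +_) (m+[n∸m]≡n m₁≤b) ⟨
    x * a + (m₁ + c)  ≡⟨ swap (x * a) m₁ c ⟩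
    x * a + c + m₁    ∎)
    where
    open ≡-Reasoning
    swap : ∀ X M C → X + (M + C) ≡ X + C + M
    swap X M C = solve (X ∷ M ∷ C ∷ [])

  P₀ : QLine
  P₀ = qline (2 * a) (2 * c + 1) (2 * d)

  IsS-P₀ : IsS P₀
  IsS-P₀ = *-monoʳ-< 2 0<a , *-monoʳ-< 2 a<d , m≤n+m 1 (2 * c) , 2*-<-2*+1 c<d
    where c<d = ≤-<-trans (m∸n≤m b m₁) b<d

  floorAt-P₀ : ∀ x → floorAt P₀ x ≡ fl x
  floorAt-P₀ x = trans (cong (_/ (2 * d)) numerator) ([m*n+o]/n≡m (fl x) (2 * d) (2*-<-2*+1 δ<d))
    where
    open ≡-Reasoning
    δ = rem x ∸ m₁
    δ<d : δ < d
    δ<d = ≤-<-trans (m∸n≤m (rem x) m₁) (rem<d x)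
    swap : ∀ M X Y → M + (X + Y) ≡ X + (M + Y)
    swap M X Y = solve (M ∷ X ∷ Y ∷ [])
    level-gap : fl x * d + δ ≡ x * a + c
    level-gap = +-cancelˡ-≡ m₁ _ _ (begin
      m₁ + (fl x * d + δ)  ≡⟨ swap m₁ (fl x * d) δ ⟩
      fl x * d + (m₁ + δ)  ≡⟨ cong (fl x * d +_) (m+[n∸m]≡n (m₁≤rem x)) ⟩
      fl x * d + rem x     ≡⟨ fl*d+rem x ⟩
      x * a + b            ≡⟨ cong (x * a +_) (m+[n∸m]≡n m₁≤b) ⟨
      x * a + (m₁ + c)     ≡⟨ swap m₁ (x * a) c ⟨
      m₁ + (x * a + c)     ∎)
    numerator : x * (2 * a) + (2 * c + 1) ≡ fl x * (2 * d) + (2 * δ + 1)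
    numerator = begin
      x * (2 * a) + (2 * c + 1)     ≡⟨ x*[2a]+[2c+1]≡2[xa+c]+1 x a c ⟩
      2 * (x * a + c) + 1           ≡⟨ cong (λ t → 2 * t + 1) level-gap ⟨
      2 * (fl x * d + δ) + 1        ≡⟨ x*[2a]+[2c+1]≡2[xa+c]+1 (fl x) d δ ⟨
      fl x * (2 * d) + (2 * δ + 1)  ∎

  K : ℕ
  K = n + 9 * d

  i₁ : ℕ
  i₁ = z₁ + K * d

  i₂ : ℕ
  i₂ = z₁ + suc K * d

  N : ℕ
  N = 2 * i₁ + 1

  w′ : Word
  w′ = lineWord P₀ N

  w′-goesThrough-fl : ∀ {x} → x ≤ N → GoesThrough w′ x (fl x)
  w′-goesThrough-fl {x} x≤N =
    trans (lineWord-goesThrough-floorAt P₀ (proj₁ (proj₂ IsS-P₀)) (proj₂ (proj₂ (proj₂ IsS-P₀))) x≤N) (floorAt-P₀ x)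

  n≤K*d : n ≤ K * d
  n≤K*d = ≤-trans (m≤m+n n (9 * d)) (m≤m*n K d)

  d≤i₁ : d ≤ i₁
  d≤i₁ = ≤-trans (m≤n*m d K {{>-nonZero 0<K}}) (m≤n+m (K * d) z₁)
    where 0<K = ≤-trans (≤-trans (>-nonZero⁻¹ d) (m≤n*m d 9)) (m≤n+m (9 * d) n)

  2i₁≤N : 2 * i₁ ≤ N
  2i₁≤N = m≤m+n (2 * i₁) 1

  i₁+d≡i₂ : i₁ + d ≡ i₂
  i₁+d≡i₂ = next-level-point z₁ K

  i₁<i₂ : i₁ < i₂
  i₁<i₂ = subst (i₁ <_) i₁+d≡i₂ (m<m+n i₁ (>-nonZero⁻¹ d))

  i₂≤N : i₂ ≤ N
  i₂≤N = begin
    i₂            ≡⟨ i₁+d≡i₂ ⟨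
    i₁ + d        ≤⟨ +-monoʳ-≤ i₁ d≤i₁ ⟩
    i₁ + i₁       ≤⟨ +-monoʳ-≤ i₁ (m≤m+n i₁ 0) ⟩
    2 * i₁        ≤⟨ 2i₁≤N ⟩
    N             ∎
    where open ≤-Reasoning

  N<2i₂ : N < 2 * i₂
  N<2i₂ = 2*-<-2*+1 i₁<i₂

  n≤N : n ≤ N
  n≤N = ≤-trans n≤K*d (≤-trans (m≤n+m (K * d) z₁) (≤-trans (m≤n*m i₁ 2) 2i₁≤N))

  N-large : 18 * (d * d) ≤ N
  N-large = begin
    18 * (d * d)      ≡⟨ solve (d ∷ []) ⟩
    2 * (9 * d * d)   ≤⟨ *-monoʳ-≤ 2 (*-monoˡ-≤ d (m≤n+m (9 * d) n)) ⟩
    2 * (K * d)       ≤⟨ *-monoʳ-≤ 2 (m≤n+m (K * d) z₁) ⟩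
    2 * i₁            ≤⟨ 2i₁≤N ⟩
    N                 ∎
    where open ≤-Reasoning

  y*[2d]≡2[yd] : ∀ y → y * (2 * d) ≡ 2 * (y * d)
  y*[2d]≡2[yd] y = solve (y ∷ d ∷ [])

  on-ℓ₁ : ∀ k → OnLine ℓ₁ (z₁ + k * d) (fl (z₁ + k * d))
  on-ℓ₁ k = OnLevel⇒OnLine-ℓ₁ (z₁ + k * d) (fl (z₁ + k * d)) (OnLevel-rem z₁ k)

  OnLine-ℓ₁⇒Above-P₀ : ∀ x y → OnLine ℓ₁ x y → Above P₀ x y
  OnLine-ℓ₁⇒Above-P₀ x y on = begin-strict
    y * (2 * d)                ≡⟨ y*[2d]≡2[yd] y ⟩
    2 * (y * d)                <⟨ m<m+n (2 * (y * d)) z<s ⟩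
    2 * (y * d) + 1            ≡⟨ cong (λ t → 2 * t + 1) on ⟩
    2 * (x * a + c) + 1        ≡⟨ x*[2a]+[2c+1]≡2[xa+c]+1 x a c ⟨
    x * (2 * a) + (2 * c + 1)  ∎
    where open ≤-Reasoning

  no-point-between-ℓ₁-P₀ : ∀ {M} → NoPointBetween M ℓ₁ P₀
  no-point-between-ℓ₁-P₀ i j _ _ (inj₁ (ℓ₁-above , P₀-below)) =
    <⇒2*≮2*+1 ℓ₁-above (<-≤-trans (<-trans (m<m+n _ z<s)
      (subst₂ _<_ (x*[2a]+[2c+1]≡2[xa+c]+1 i a c) (y*[2d]≡2[yd] j) P₀-below)) (m≤m+n _ 1))
  no-point-between-ℓ₁-P₀ i j _ _ (inj₂ (P₀-above , ℓ₁-below)) =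
    <⇒2*≮2*+1 ℓ₁-below (subst₂ _<_ (y*[2d]≡2[yd] j) (x*[2a]+[2c+1]≡2[xa+c]+1 i a c) P₀-above)

  ℓ₁∈L : IsL N ℓ₁
  ℓ₁∈L = <⇒≤ a<d , ≤-trans (m∸n≤m b m₁) (<⇒≤ b<d)
       , i₁ , fl i₁ , i₂ , fl i₂ , i₁<i₂ , i₂≤N , on-ℓ₁ K , on-ℓ₁ (suc K)

  w′∈m[ℓ₁] : InM N ℓ₁ w′
  w′∈m[ℓ₁] = length-lineWord P₀ N , P₀ , IsS-P₀ , cong (lineWord P₀) (length-lineWord P₀ N) , no-point-between-ℓ₁-P₀
           , i₁ , fl i₁ , i₂ , fl i₂ , on-ℓ₁ K , on-ℓ₁ (suc K) , 2i₁≤N , N<2i₂ , i₂≤N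
           , OnLine-ℓ₁⇒Above-P₀ i₁ (fl i₁) (on-ℓ₁ K) , OnLine-ℓ₁⇒Above-P₀ i₂ (fl i₂) (on-ℓ₁ (suc K))

  residue-above-lowest : ∃[ z ] (z < d × m₁ < rem z)
  residue-above-lowest with m₁ <? rem 0
  ... | yes m₁<rem0 = 0 , >-nonZero⁻¹ d , m₁<rem0
  ... | no  m₁≮rem0 = 1 , ≤-<-trans 0<a a<d , ≤∧≢⇒< (m₁≤rem 1) m₁≢rem1
    where
    rem1≢b : rem 1 ≢ b
    rem1≢b rem1≡b = m*n≢o (fl 1) 0<a a<d (begin
      fl 1 * d          ≡⟨ +-cancelʳ-≡ b (fl 1 * d) (1 * a) (trans (cong (fl 1 * d +_) (sym rem1≡b)) (fl*d+rem 1)) ⟩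
      1 * a             ≡⟨ *-identityˡ a ⟩
      a                 ∎)
      where open ≡-Reasoning
    m₁≢rem1 : m₁ ≢ rem 1
    m₁≢rem1 m₁≡rem1 =
      rem1≢b (trans (sym m₁≡rem1) (≤-antisym m₁≤b (subst (_≤ m₁) (m<n⇒m%n≡m b<d) (≮⇒≥ m₁≮rem0))))

  opaque
    second-lowest : ∃[ z ] (z < d × m₁ < rem z × (∀ {y} → y < d → m₁ < rem y → rem z ≤ rem y))
    second-lowest = minimiser-below {P = λ z → m₁ < rem z} (λ z → m₁ <? rem z) rem
      (proj₁ (proj₂ residue-above-lowest)) (proj₂ (proj₂ residue-above-lowest))

  z₂ : ℕ
  z₂ = proj₁ second-lowest

  m₂ : ℕ
  m₂ = rem z₂

  m₁<m₂ : m₁ < m₂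
  m₁<m₂ = proj₁ (proj₂ (proj₂ second-lowest))

  m₂≤rem : ∀ x → m₁ < rem x → m₂ ≤ rem x
  m₂≤rem x m₁<rem = subst (m₂ ≤_) (sym (rem≡rem[x%d] x))
    (proj₂ (proj₂ (proj₂ second-lowest)) (m%n<n x d) (subst (m₁ <_) (rem≡rem[x%d] x) m₁<rem))

  module Witness (p r D : ℕ) {{D≢0 : NonZero D}} (p<D : p < D) (r<D : r < D)
                 (defines : lineWord (qline p r D) N ≡ w′) where

    P : QLine
    P = qline p r D

    floorAt-P : ∀ {x} → x ≤ N → floorAt P x ≡ fl x
    floorAt-P {x} x≤N = begin
      floorAt P x                   ≡⟨ lineWord-goesThrough-floorAt P p<D r<D x≤N ⟨
      ones (take x (lineWord P N))  ≡⟨ cong (λ v → ones (take x v)) defines ⟩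
      ones (take x w′)              ≡⟨ w′-goesThrough-fl x≤N ⟩
      fl x                          ∎
      where open ≡-Reasoning

    Above-P⇒≤fl : ∀ i j → i ≤ N → Above P i j → j ≤ fl i
    Above-P⇒≤fl i j i≤N above = subst (j ≤_) (floorAt-P i≤N) (Above⇒≤floorAt P i above)

    OnLine-P-unless-Above : ∀ x → x ≤ N → ¬ Above P x (fl x) → OnLine P x (fl x)
    OnLine-P-unless-Above x x≤N not-above =
      ≤-antisym (subst (λ f → f * D ≤ x * p + r) (floorAt-P x≤N) (floorAt-≤-line P x)) (≮⇒≥ not-above)

    module NotLowest (not-ℓ₁ : ¬ (a * D ≡ p * d × r * d + m₁ * D ≡ b * D)) where

      under-level₁ : ∀ i j → i ≤ N → Above P i j → j * d + m₁ ≤ i * a + b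
      under-level₁ i j i≤N above = begin
        j * d + m₁        ≤⟨ +-mono-≤ (*-monoˡ-≤ d (Above-P⇒≤fl i j i≤N above)) (m₁≤rem i) ⟩
        fl i * d + rem i  ≡⟨ fl*d+rem i ⟩
        i * a + b         ∎
        where open ≤-Reasoning

      P-above-level₁ : ∀ k → z₁ + suc k * d ≤ N →
        Above P (z₁ + k * d) (fl (z₁ + k * d)) ⊎ Above P (z₁ + suc k * d) (fl (z₁ + suc k * d))
      P-above-level₁ k in-range with (fl x * D) <? (x * p + r) | (fl x′ * D) <? (x′ * p + r)
        where
        x = z₁ + k * d
        x′ = z₁ + suc k * d
      ... | yes above | _         = inj₁ above
      ... | no _      | yes above′ = inj₂ above′
      ... | no not-above | no not-above′ = ⊥-elim (not-ℓ₁ (level-line-through p r D m₁ x x′ (fl x) (fl x′)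
            (next-level-point z₁ k) (OnLevel-rem z₁ k) (OnLevel-rem z₁ (suc k))
            (OnLine-P-unless-Above x x≤N not-above) (OnLine-P-unless-Above x′ in-range not-above′)))
        where
        x = z₁ + k * d
        x′ = z₁ + suc k * d
        x≤N = ≤-trans (+-monoʳ-≤ z₁ (m≤n+m (k * d) d)) in-range

    module Lowest (aD≡pd : a * D ≡ p * d) (rd+m₁D≡bD : r * d + m₁ * D ≡ b * D) where

      open LevelLine p r D m₁ aD≡pd rd+m₁D≡bD

      under-level₂ : ∀ i j → i ≤ N → Above P i j → j * d + m₂ ≤ i * a + b
      under-level₂ i j i≤N above with m≤n⇒m<n∨m≡n (Above-P⇒≤fl i j i≤N above)
      ... | inj₁ j<fl = begin
        j * d + m₂        ≤⟨ +-monoʳ-≤ (j * d) (<⇒≤ (rem<d z₂)) ⟩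
        j * d + d         ≡⟨ +-comm (j * d) d ⟩
        suc j * d         ≤⟨ *-monoˡ-≤ d j<fl ⟩
        fl i * d          ≤⟨ m≤m+n (fl i * d) (rem i) ⟩
        fl i * d + rem i  ≡⟨ fl*d+rem i ⟩
        i * a + b         ∎
        where open ≤-Reasoning
      ... | inj₂ refl = begin
        fl i * d + m₂     ≤⟨ +-monoʳ-≤ (fl i * d) (m₂≤rem i m₁<rem) ⟩
        fl i * d + rem i  ≡⟨ fl*d+rem i ⟩
        i * a + b         ∎
        where
        open ≤-Reasoning
        m₁<rem : m₁ < rem i
        m₁<rem = +-cancelˡ-< (fl i * d) m₁ (rem i)
          (subst (fl i * d + m₁ <_) (sym (fl*d+rem i)) (Above⇒above-level i (fl i) above))

      P-above-level₂ : ∀ k → Above P (z₂ + k * d) (fl (z₂ + k * d))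
      P-above-level₂ k = above-level⇒Above x (fl x)
        (subst (fl x * d + m₁ <_) (OnLevel-rem z₂ k) (+-monoʳ-< (fl x * d) m₁<m₂))
        where x = z₂ + k * d

    OnLine-ℓ⇒≡fl : ∀ s o e {{_ : NonZero e}} → s ≤ e → o ≤ e → NoPointBetween N (qline s o e) P →
      ∀ i₁ j₁ i₂ j₂ → OnLine (qline s o e) i₁ j₁ → OnLine (qline s o e) i₂ j₂ →
      2 * i₁ ≤ N → N < 2 * i₂ → i₂ ≤ N → Above P i₁ j₁ → Above P i₂ j₂ →
      ∀ x y → OnLine (qline s o e) x y → y ≡ fl x
    -- When P is ℓ₁ itself the level-m₁ points lie on P rather than under it, and the next level takes over.
    OnLine-ℓ⇒≡fl s o e s≤e o≤e empty with (a * D ≟ p * d) ×-dec (r * d + m₁ * D ≟ b * D)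
    ... | yes (aD≡pd , rd+m₁D≡bD) =
      Rigidity.rigid N N-large P p<D r<D floorAt-P m₂ z₂ (rem<d z₂) (proj₁ (proj₂ second-lowest)) (OnLevel-rem z₂)
        under-level₂ (λ k _ → inj₁ (P-above-level₂ k)) s o e s≤e o≤e empty
      where open Lowest aD≡pd rd+m₁D≡bD
    ... | no not-ℓ₁ =
      Rigidity.rigid N N-large P p<D r<D floorAt-P m₁ z₁ (rem<d z₁) (proj₁ (proj₂ lowest)) (OnLevel-rem z₁)
        under-level₁ P-above-level₁ s o e s≤e o≤e empty
      where open NotLowest not-ℓ₁

  goes-through : ∀ ℓ → IsL N ℓ → InM N ℓ w′ → ∀ i j → i ≤ N → OnLine ℓ i j → GoesThrough w′ i j
  goes-through (qline s o e) (s≤e , o≤e , _)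
    (_ , qline p r D , (_ , p<D , _ , r<D) , defines , empty ,
         (k₁ , l₁ , k₂ , l₂ , on₁ , on₂ , 2k₁≤N , N<2k₂ , k₂≤N , above₁ , above₂))
    i j i≤N on =
      trans (w′-goesThrough-fl i≤N) (sym (Witness.OnLine-ℓ⇒≡fl p r D p<D r<D defines-N s o e s≤e o≤e empty
        k₁ l₁ k₂ l₂ on₁ on₂ 2k₁≤N N<2k₂ k₂≤N above₁ above₂ i j on))
    where
    defines-N = trans (cong (lineWord (qline p r D)) (sym (length-lineWord P₀ N))) defines

  extension-in-m : ∃[ ℓ ] (IsL (length w′) ℓ × InM (length w′) ℓ w′)
  extension-in-m =
    subst (λ M → ∃[ ℓ ] (IsL M ℓ × InM M ℓ w′)) (sym (length-lineWord P₀ N)) (ℓ₁ , ℓ₁∈L , w′∈m[ℓ₁])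

  extension-goes-through : ∀ ℓ → IsL (length w′) ℓ → InM (length w′) ℓ w′ →
    ∀ i j → i ≤ length w′ → OnLine ℓ i j → GoesThrough w′ i j
  extension-goes-through =
    subst (λ M → ∀ ℓ → IsL M ℓ → InM M ℓ w′ → ∀ i j → i ≤ M → OnLine ℓ i j → GoesThrough w′ i j)
      (sym (length-lineWord P₀ N)) goes-through

  extension-Sturmian : Sturmian w′
  extension-Sturmian = P₀ , IsS-P₀ , cong (lineWord P₀) (length-lineWord P₀ N)

  prefix-of-extension : ∀ {w} → lineWord ℓ₀ n ≡ w → IsPrefix w w′
  prefix-of-extension {w} defines = drop n w′ , (begin
    w ++ drop n w′                 ≡⟨ cong (_++ drop n w′) w≡take ⟩
    take n w′ ++ drop n w′         ≡⟨ take++drop≡id n w′ ⟩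
    w′                             ∎)
    where
    open ≡-Reasoning
    w≡take : w ≡ take n w′
    w≡take = begin
      w                 ≡⟨ defines ⟨
      lineWord ℓ₀ n     ≡⟨ lineWord-cong ℓ₀ P₀ (λ x → sym (floorAt-P₀ x)) n ⟩
      lineWord P₀ n     ≡⟨ take-lineWord P₀ n≤N ⟨
      take n w′         ∎

lemma2p3 : ∀ w → Sturmian w →
    ∃[ w' ] ( IsPrefix w w' × Sturmian w'
            × (∃[ ℓ ] (IsL (length w') ℓ × InM (length w') ℓ w'))
            × (∀ ℓ → IsL (length w') ℓ → InM (length w') ℓ w' →
                 ∀ i j → i ≤ length w' → OnLine ℓ i j → GoesThrough w' i j))
lemma2p3 w (qline a b d , (0<a , a<d , _ , b<d) , defines) =
  w′ , prefix-of-extension defines , extension-Sturmian , extension-in-m , extension-goes-through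
  where open Extension a b d 0<a a<d b<d (length w)
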